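{- Let $n\in\mathbb{N}$ with $n>1$ and let $A\subseteq\mathbb{N}$ be multiplicatively piecewise syndetic. Then there exist $x,y\in A$ such that $x\,n^{y}\in A$.
   Context: $\mathbb{N}=\{1,2,3,\dots\}$. For $f\in\mathbb{N}$ and $B\subseteq\mathbb{N}$ write $f^{ -1}B=\{y\in\mathbb{N}: fy\in B\}$. A set $T\subseteq\mathbb{N}$ is multiplicatively thick if for every finite $H\subseteq\mathbb{N}$ there is $x\in\mathbb{N}$ with $Hx=\{hx:h\in H\}\subseteq T$. A set $A\subseteq\mathbb{N}$ is multiplicatively piecewise syndetic if there is a finite set $F\subseteq\mathbb{N}$ such that $\bigcup_{f\in F}f^{ -1}A$ is multiplicatively thick. -}

module Defs where

open import Level using (0ℓ)
open import Data.Nat using (ℕ; _*_; _^_; _≤_)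
open import Data.Product using (Σ; ∃; _×_; _,_)
open import Data.List using (List)
open import Data.List.Relation.Unary.All using (All)
open import Data.List.Membership.Propositional using (_∈_)
open import Relation.Unary using (Pred)

-- Subsets of ℕ = {1,2,3,...} are predicates on Agda's ℕ; only positive
-- arguments are ever consulted.  Finite subsets of ℕ = lists of positive naturals.

_⁻¹·_ : ℕ → Pred ℕ 0ℓ → Pred ℕ 0ℓ
(f ⁻¹· B) y = B (f * y)

MultThick : Pred ℕ 0ℓ → Set
MultThick T = (H : List ℕ) → All (1 ≤_) H →
  Σ ℕ λ x → (1 ≤ x) × ((h : ℕ) → h ∈ H → T (h * x))

BigUnionPreimage : List ℕ → Pred ℕ 0ℓ → Pred ℕ 0ℓ
BigUnionPreimage F A y = Σ ℕ λ f → (f ∈ F) × (f ⁻¹· A) y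

MultPiecewiseSyndetic : Pred ℕ 0ℓ → Set
MultPiecewiseSyndetic A = Σ (List ℕ) λ F → All (1 ≤_) F × MultThick (BigUnionPreimage F A)

{-# OPTIONS --safe #-}
module Submission where

open import Defs
open import Level using (0ℓ)
open import Data.Nat using (ℕ; suc; _+_; _*_; _^_; _∸_; _≤_; _<_; s≤s; z≤n; NonZero; >-nonZero)
open import Data.Nat.Properties
  using (*-mono-≤; ^-distribˡ-+-*; m^n>0; n<1+n; m∸n≤m; m<n⇒0<n∸m; m+[n∸m]≡n; <⇒≤; ≤-trans; ≤-pred)
open import Data.Nat.Tactic.RingSolver using (solve-∀)
open import Data.Product using (Σ; ∃₂; _×_; _,_; proj₁; proj₂)
open import Data.Fin as Fin using (Fin; toℕ; funToFin; finToFun)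
open import Data.Fin.Properties using (pigeonhole; finToFun-funToFin; toℕ<n)
open import Data.List as List using (List; map; upTo; allFin; cartesianProduct)
import Data.List.Relation.Unary.All as All
open import Data.List.Relation.Unary.All.Properties using (map⁺)
open import Data.List.Relation.Unary.Any using (index)
open import Data.List.Relation.Unary.Any.Properties using (lookup-index)
open import Data.List.Membership.Propositional using (_∈_)
open import Data.List.Membership.Propositional.Properties
  using (∈-map⁺; ∈-upTo⁺; ∈-allFin; ∈-cartesianProduct⁺; ∈-lookup)
open import Relation.Binary.PropositionalEquality
  using (_≡_; _≗_; sym; cong; cong₂; subst; module ≡-Reasoning)
open import Relation.Unary using (Pred; _⊆_)
open import Function using (_∘_)

-- Let F = {a₁, …, a_k} and K = k^k.  Thickness of ⋃ aᵢ⁻¹A gives x₁ with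
-- d x₁ ∈ ⋃ aᵢ⁻¹A for 1 ≤ d ≤ K, and then x₂ with n^(aₗ i x₁) x₂ ∈ ⋃ aᵢ⁻¹A for
-- every l and 0 ≤ i ≤ K.  Colour i by the map χᵢ sending l to an index c with
-- a_c n^(aₗ i x₁) x₂ ∈ A; there are only K colours, so χᵢ = χⱼ for some i < j.
-- With d = j - i pick l such that y = aₗ d x₁ ∈ A; then x = a_c n^(aₗ i x₁) x₂
-- for c = χᵢ l = χⱼ l lies in A, and x n^y = a_c n^(aₗ j x₁) x₂ ∈ A.

HasExpPattern : ℕ → Pred ℕ 0ℓ → Set
HasExpPattern n A = Σ ℕ λ x → Σ ℕ λ y → (1 ≤ x) × (1 ≤ y) × A x × A y × A (x * n ^ y)

FinUnionPreimage : ∀ {k} → (Fin k → ℕ) → Pred ℕ 0ℓ → Pred ℕ 0ℓ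
FinUnionPreimage {k} a A y = Σ (Fin k) λ c → (a c ⁻¹· A) y

BigUnionPreimage⊆FinUnionPreimage : ∀ F A →
  BigUnionPreimage F A ⊆ FinUnionPreimage (List.lookup F) A
BigUnionPreimage⊆FinUnionPreimage F A {y} (f , f∈F , Afy) =
  index f∈F , subst (λ g → A (g * y)) (lookup-index f∈F) Afy

MultThick-mono : ∀ {T U : Pred ℕ 0ℓ} → T ⊆ U → MultThick T → MultThick U
MultThick-mono T⊆U thick H H⁺ with thick H H⁺
... | x , x⁺ , Hx⊆T = x , x⁺ , λ h h∈H → T⊆U (Hx⊆T h h∈H)

MultThick-indexed : ∀ {T : Pred ℕ 0ℓ} → MultThick T → {I : Set} (L : List I) (h : I → ℕ) →
  (∀ i → 1 ≤ h i) → Σ ℕ λ x → (1 ≤ x) × (∀ i → i ∈ L → T (h i * x))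
MultThick-indexed thick L h h⁺ with thick (map h L) (map⁺ (All.universal h⁺ L))
... | x , x⁺ , hLx⊆T = x , x⁺ , λ i i∈L → hLx⊆T (h i) (∈-map⁺ h i∈L)

MultThick-interval : ∀ {T : Pred ℕ 0ℓ} → MultThick T → (K : ℕ) →
  Σ ℕ λ x → (1 ≤ x) × (∀ d → 1 ≤ d → d ≤ K → T (d * x))
MultThick-interval {T} thick K with MultThick-indexed {T} thick (upTo K) suc (λ _ → s≤s z≤n)
... | x , x⁺ , covered = x , x⁺ , λ { (suc d) _ d<K → covered d (∈-upTo⁺ d<K) }

pigeonhole-≗ : ∀ {k m} (χ : Fin (suc (k ^ m)) → Fin m → Fin k) →
  ∃₂ λ i j → i Fin.< j × χ i ≗ χ j
pigeonhole-≗ χ with pigeonhole (n<1+n _) (funToFin ∘ χ)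
... | i , j , i<j , eq = i , j , i<j , λ l → begin
    χ i l                       ≡⟨ sym (finToFun-funToFin (χ i) l) ⟩
    finToFun (funToFin (χ i)) l ≡⟨ cong (λ e → finToFun e l) eq ⟩
    finToFun (funToFin (χ j)) l ≡⟨ finToFun-funToFin (χ j) l ⟩
    χ j l                       ∎
  where open ≡-Reasoning

*-^-merge : ∀ g n e e′ z → g * (n ^ e * z) * n ^ e′ ≡ g * (n ^ (e + e′) * z)
*-^-merge g n e e′ z = begin
  g * (n ^ e * z) * n ^ e′     ≡⟨ rearrange g (n ^ e) (n ^ e′) z ⟩
  g * (n ^ e * n ^ e′ * z)     ≡⟨ cong (λ p → g * (p * z)) (sym (^-distribˡ-+-* n e e′)) ⟩
  g * (n ^ (e + e′) * z)       ∎
  where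
  open ≡-Reasoning
  rearrange : ∀ g p q z → g * (p * z) * q ≡ g * (p * q * z)
  rearrange = solve-∀

module ExpPattern {k : ℕ} (n : ℕ) .{{_ : NonZero n}} (A : Pred ℕ 0ℓ)
  (a : Fin k → ℕ) (a⁺ : ∀ c → 1 ≤ a c) {x₁ x₂ : ℕ} (x₁⁺ : 1 ≤ x₁) (x₂⁺ : 1 ≤ x₂)
  (interval : ∀ d → 1 ≤ d → d ≤ k ^ k → FinUnionPreimage a A (d * x₁))
  (powers : ∀ l (i : Fin (suc (k ^ k))) → FinUnionPreimage a A (n ^ (a l * toℕ i * x₁) * x₂))
  where

  χ : Fin (suc (k ^ k)) → Fin k → Fin k
  χ i l = proj₁ (powers l i)

  point : Fin (suc (k ^ k)) → Fin k → ℕ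
  point i l = a (χ i l) * (n ^ (a l * toℕ i * x₁) * x₂)

  point∈A : ∀ i l → A (point i l)
  point∈A i l = proj₂ (powers l i)

  point⁺ : ∀ i l → 1 ≤ point i l
  point⁺ i l = *-mono-≤ (a⁺ (χ i l)) (*-mono-≤ (m^n>0 n (a l * toℕ i * x₁)) x₂⁺)

  point-shift : ∀ {i j} l → toℕ i ≤ toℕ j → χ i l ≡ χ j l →
    point i l * n ^ (a l * ((toℕ j ∸ toℕ i) * x₁)) ≡ point j l
  point-shift {i} {j} l i≤j χil≡χjl = begin
    point i l * n ^ (a l * (d * x₁))
      ≡⟨ *-^-merge (a (χ i l)) n (a l * toℕ i * x₁) (a l * (d * x₁)) x₂ ⟩
    a (χ i l) * (n ^ (a l * toℕ i * x₁ + a l * (d * x₁)) * x₂)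
      ≡⟨ cong (λ e → a (χ i l) * (n ^ e * x₂)) (exponent (a l) (toℕ i) d x₁) ⟩
    a (χ i l) * (n ^ (a l * (toℕ i + d) * x₁) * x₂)
      ≡⟨ cong₂ (λ c t → a c * (n ^ (a l * t * x₁) * x₂)) χil≡χjl (m+[n∸m]≡n i≤j) ⟩
    point j l
      ∎
    where
    open ≡-Reasoning
    d = toℕ j ∸ toℕ i
    exponent : ∀ b t s x → b * t * x + b * (s * x) ≡ b * (t + s) * x
    exponent = solve-∀

  pattern-from-gap : ∀ i j → i Fin.< j → χ i ≗ χ j → HasExpPattern n A
  pattern-from-gap i j i<j χi≗χj with interval (toℕ j ∸ toℕ i) (m<n⇒0<n∸m i<j) gap≤K
    where
    gap≤K : toℕ j ∸ toℕ i ≤ k ^ k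
    gap≤K = ≤-trans (m∸n≤m (toℕ j) (toℕ i)) (≤-pred (toℕ<n j))
  ... | l , y∈A =
    point i l , a l * ((toℕ j ∸ toℕ i) * x₁) ,
    point⁺ i l , *-mono-≤ (a⁺ l) (*-mono-≤ (m<n⇒0<n∸m i<j) x₁⁺) ,
    point∈A i l , y∈A ,
    subst A (sym (point-shift l (<⇒≤ i<j) (χi≗χj l))) (point∈A j l)

  expPattern : HasExpPattern n A
  expPattern with pigeonhole-≗ χ
  ... | i , j , i<j , χi≗χj = pattern-from-gap i j i<j χi≗χj

FinUnionPreimage-thick⇒HasExpPattern : ∀ {k} n .{{_ : NonZero n}} (A : Pred ℕ 0ℓ)
  (a : Fin k → ℕ) → (∀ c → 1 ≤ a c) → MultThick (FinUnionPreimage a A) → HasExpPattern n A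
FinUnionPreimage-thick⇒HasExpPattern {k} n A a a⁺ thick
  with MultThick-interval {FinUnionPreimage a A} thick (k ^ k)
... | x₁ , x₁⁺ , interval
  with MultThick-indexed {FinUnionPreimage a A} thick
         (cartesianProduct (allFin k) (allFin (suc (k ^ k))))
         (λ (l , i) → n ^ (a l * toℕ i * x₁)) (λ (l , i) → m^n>0 n (a l * toℕ i * x₁))
... | x₂ , x₂⁺ , powers =
  ExpPattern.expPattern n A a a⁺ x₁⁺ x₂⁺ interval
    (λ l i → powers (l , i) (∈-cartesianProduct⁺ (∈-allFin l) (∈-allFin i)))

theorem1p6 : (n : ℕ) → 1 < n → (A : Pred ℕ 0ℓ) → MultPiecewiseSyndetic A →
    Σ ℕ λ x → Σ ℕ λ y → (1 ≤ x) × (1 ≤ y) × A x × A y × A (x * n ^ y)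
theorem1p6 n 1<n A (F , F⁺ , thick) =
  FinUnionPreimage-thick⇒HasExpPattern n {{>-nonZero (<⇒≤ 1<n)}} A (List.lookup F)
    (λ c → All.lookup F⁺ (∈-lookup c))
    (MultThick-mono {BigUnionPreimage F A} (BigUnionPreimage⊆FinUnionPreimage F A) thick)
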